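{- Let $\pi$ be a proof in $\mathcal{G}$ containing a segment consisting of a sequent $\Phi \vdash C$ followed by $e+n$ consecutive applications of (W) and then by consecutive applications of (C), ending with the sequent $\Psi \vdash C$, where among these applications of (W) exactly $e$ are engaged in $\pi$ and $n$ are neutral in $\pi$. Then this segment can be transformed into a segment which starts with $\Phi \vdash C$, consists of applications of (C) followed by $e+n$ applications of (W), and ends with $\Psi \vdash C$, where among these applications of (W) $e$ are engaged and $n$ are neutral in the transformed proof. The degree of the transformed proof is the same as the degree of $\pi$.
   Context: Formulae are built from propositional variables and $\bot$ with the binary connectives $\wedge,\vee,\rightarrow$. Sequents have the form $\Gamma \vdash C$, $\Gamma$ a finite (possibly empty) sequence of formulae, $C$ a formula. The system $\mathcal{G}$ has axioms $A \vdash A$ and $\bot \vdash A$ and rules: (C) from $\Delta, A, B, \Gamma \vdash C$ infer $\Delta, B, A, \Gamma \vdash C$; (W) from $\Theta, A, A, \Gamma \vdash C$ infer $\Theta, A, \Gamma \vdash C$; (K) from $\Theta, \Gamma \vdash C$ infer $\Theta, A, \Gamma \vdash C$; (cut) from $\Delta \vdash A$ and $\Theta, A, \Gamma \vdash C$ infer $\Theta, \Delta, \Gamma \vdash C$ ($A$ is the cut formula); ($\wedge$L) from $\Theta, A, \Gamma \vdash C$ (resp. $\Theta, B, \Gamma \vdash C$) infer $\Theta, A\wedge B, \Gamma \vdash C$; ($\wedge$R) from $\Gamma \vdash A$ and $\Gamma \vdash B$ infer $\Gamma \vdash A \wedge B$; ($\vee$L) from $\Theta, A, \Gamma \vdash C$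 and $\Theta, B, \Gamma \vdash C$ infer $\Theta, A \vee B, \Gamma \vdash C$; ($\vee$R) from $\Gamma \vdash A$ (resp. $\Gamma \vdash B$) infer $\Gamma \vdash A \vee B$; ($\rightarrow$L) from $\Delta \vdash A$ and $\Theta, B, \Gamma \vdash C$ infer $\Theta, \Delta, A \rightarrow B, \Gamma \vdash C$; ($\rightarrow$R) from $A, \Gamma \vdash B$ infer $\Gamma \vdash A \rightarrow B$. Applications of (W) are called contractions, applications of (cut) cuts. The degree of a cut is the number of binary connectives in its cut formula; the degree of a proof is the maximal degree of its cuts (0 if there are none). Clusters: in each inference, each occurrence of a formula in the antecedent of the conclusion lying in a context sequence ($\Theta,\Delta,\Gamma$ of the schema) has as immediate ancestors the occurrences at the corresponding place in the premise(s) (in both premises for ($\wedge$R), ($\vee$L)); in (C) the displayed $B, A$ of the conclusion have as immediate ancestors the displayed $B$, $A$ of the premise; in (W) the displayed (contracted, principal) occurrence of $A$ in the conclusion has both displayed occurrences of $A$ of the premise as immediate ancestors. The cluster of an occurrence $G$ of a formula in a proof is the set of occurrences obtained from $G$ by iterating the immediate-ancestor relation (including $G$). An application of (W) in a proof $\pi$ is engaged iff its principal (contracted) occurrence in its conclusion belongs to the cluster of the occurrence of the cut formula in the right premise of some cut in $\pi$; otherwise it is neutral. -}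

module Defs where

open import Data.Nat using (ℕ; zero; suc; _+_; _∸_; _⊔_; _<ᵇ_; _≡ᵇ_; pred)
open import Data.Bool using (Bool; true; false; if_then_else_; _∨_)
open import Data.List using (List; []; _∷_; _++_; length)

infixr 6 _∧f_
infixr 5 _∨f_
infixr 4 _⇒f_

data Fm : Set where
  var  : ℕ → Fm
  ⊥f   : Fm
  _∧f_ : Fm → Fm → Fm
  _∨f_ : Fm → Fm → Fm
  _⇒f_ : Fm → Fm → Fm

conn : Fm → ℕ
conn (var _)  = 0
conn ⊥f       = 0
conn (A ∧f B) = suc (conn A + conn B)
conn (A ∨f B) = suc (conn A + conn B)
conn (A ⇒f B) = suc (conn A + conn B)

-- The splittings of the antecedent (Θ, Δ, Γ of the rule schemata) are
-- explicit arguments, so each inference determines its displayed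
-- occurrences (needed for clusters).

data Pf : List Fm → Fm → Set where
  ax    : ∀ A → Pf (A ∷ []) A
  axBot : ∀ A → Pf (⊥f ∷ []) A
  exch  : ∀ Δ A B Γ {C} → Pf (Δ ++ A ∷ B ∷ Γ) C → Pf (Δ ++ B ∷ A ∷ Γ) C      -- (C)
  contr : ∀ Θ A Γ {C} → Pf (Θ ++ A ∷ A ∷ Γ) C → Pf (Θ ++ A ∷ Γ) C            -- (W)
  weak  : ∀ Θ A Γ {C} → Pf (Θ ++ Γ) C → Pf (Θ ++ A ∷ Γ) C                    -- (K)
  cut   : ∀ Δ Θ A Γ {C} → Pf Δ A → Pf (Θ ++ A ∷ Γ) C → Pf (Θ ++ Δ ++ Γ) C
  andL1 : ∀ Θ A B Γ {C} → Pf (Θ ++ A ∷ Γ) C → Pf (Θ ++ (A ∧f B) ∷ Γ) C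
  andL2 : ∀ Θ A B Γ {C} → Pf (Θ ++ B ∷ Γ) C → Pf (Θ ++ (A ∧f B) ∷ Γ) C
  andR  : ∀ Γ A B → Pf Γ A → Pf Γ B → Pf Γ (A ∧f B)
  orL   : ∀ Θ A B Γ {C} → Pf (Θ ++ A ∷ Γ) C → Pf (Θ ++ B ∷ Γ) C → Pf (Θ ++ (A ∨f B) ∷ Γ) C
  orR1  : ∀ Γ A B → Pf Γ A → Pf Γ (A ∨f B)
  orR2  : ∀ Γ A B → Pf Γ B → Pf Γ (A ∨f B)
  impL  : ∀ Δ Θ A B Γ {C} → Pf Δ A → Pf (Θ ++ B ∷ Γ) C → Pf (Θ ++ Δ ++ (A ⇒f B) ∷ Γ) C
  impR  : ∀ A Γ B → Pf (A ∷ Γ) B → Pf Γ (A ⇒f B)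

degree : ∀ {Γ C} → Pf Γ C → ℕ
degree (ax _)            = 0
degree (axBot _)         = 0
degree (exch _ _ _ _ p)  = degree p
degree (contr _ _ _ p)   = degree p
degree (weak _ _ _ p)    = degree p
degree (cut _ _ A _ p q) = conn A ⊔ (degree p ⊔ degree q)
degree (andL1 _ _ _ _ p) = degree p
degree (andL2 _ _ _ _ p) = degree p
degree (andR _ _ _ p q)  = degree p ⊔ degree q
degree (orL _ _ _ _ p q) = degree p ⊔ degree q
degree (orR1 _ _ _ p)    = degree p
degree (orR2 _ _ _ p)    = degree p
degree (impL _ _ _ _ _ p q) = degree p ⊔ degree q
degree (impR _ _ _ p)    = degree p

-- The outermost constructor is the lowest
-- inference; its argument of type Ctx is the premise containing the hole.

data Ctx (Γ₀ : List Fm) (C₀ : Fm) : List Fm → Fm → Set where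
  hole   : Ctx Γ₀ C₀ Γ₀ C₀
  exchK  : ∀ Δ A B Γ {C} → Ctx Γ₀ C₀ (Δ ++ A ∷ B ∷ Γ) C → Ctx Γ₀ C₀ (Δ ++ B ∷ A ∷ Γ) C
  contrK : ∀ Θ A Γ {C} → Ctx Γ₀ C₀ (Θ ++ A ∷ A ∷ Γ) C → Ctx Γ₀ C₀ (Θ ++ A ∷ Γ) C
  weakK  : ∀ Θ A Γ {C} → Ctx Γ₀ C₀ (Θ ++ Γ) C → Ctx Γ₀ C₀ (Θ ++ A ∷ Γ) C
  cutLK  : ∀ Δ Θ A Γ {C} → Ctx Γ₀ C₀ Δ A → Pf (Θ ++ A ∷ Γ) C → Ctx Γ₀ C₀ (Θ ++ Δ ++ Γ) C
  cutRK  : ∀ Δ Θ A Γ {C} → Pf Δ A → Ctx Γ₀ C₀ (Θ ++ A ∷ Γ) C → Ctx Γ₀ C₀ (Θ ++ Δ ++ Γ) C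
  andL1K : ∀ Θ A B Γ {C} → Ctx Γ₀ C₀ (Θ ++ A ∷ Γ) C → Ctx Γ₀ C₀ (Θ ++ (A ∧f B) ∷ Γ) C
  andL2K : ∀ Θ A B Γ {C} → Ctx Γ₀ C₀ (Θ ++ B ∷ Γ) C → Ctx Γ₀ C₀ (Θ ++ (A ∧f B) ∷ Γ) C
  andRLK : ∀ Γ A B → Ctx Γ₀ C₀ Γ A → Pf Γ B → Ctx Γ₀ C₀ Γ (A ∧f B)
  andRRK : ∀ Γ A B → Pf Γ A → Ctx Γ₀ C₀ Γ B → Ctx Γ₀ C₀ Γ (A ∧f B)
  orLLK  : ∀ Θ A B Γ {C} → Ctx Γ₀ C₀ (Θ ++ A ∷ Γ) C → Pf (Θ ++ B ∷ Γ) C → Ctx Γ₀ C₀ (Θ ++ (A ∨f B) ∷ Γ) C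
  orLRK  : ∀ Θ A B Γ {C} → Pf (Θ ++ A ∷ Γ) C → Ctx Γ₀ C₀ (Θ ++ B ∷ Γ) C → Ctx Γ₀ C₀ (Θ ++ (A ∨f B) ∷ Γ) C
  orR1K  : ∀ Γ A B → Ctx Γ₀ C₀ Γ A → Ctx Γ₀ C₀ Γ (A ∨f B)
  orR2K  : ∀ Γ A B → Ctx Γ₀ C₀ Γ B → Ctx Γ₀ C₀ Γ (A ∨f B)
  impLLK : ∀ Δ Θ A B Γ {C} → Ctx Γ₀ C₀ Δ A → Pf (Θ ++ B ∷ Γ) C → Ctx Γ₀ C₀ (Θ ++ Δ ++ (A ⇒f B) ∷ Γ) C
  impLRK : ∀ Δ Θ A B Γ {C} → Pf Δ A → Ctx Γ₀ C₀ (Θ ++ B ∷ Γ) C → Ctx Γ₀ C₀ (Θ ++ Δ ++ (A ⇒f B) ∷ Γ) C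
  impRK  : ∀ A Γ B → Ctx Γ₀ C₀ (A ∷ Γ) B → Ctx Γ₀ C₀ Γ (A ⇒f B)

plug : ∀ {Γ₀ C₀ Γ C} → Ctx Γ₀ C₀ Γ C → Pf Γ₀ C₀ → Pf Γ C
plug hole p = p
plug (exchK Δ A B Γ K) p = exch Δ A B Γ (plug K p)
plug (contrK Θ A Γ K) p = contr Θ A Γ (plug K p)
plug (weakK Θ A Γ K) p = weak Θ A Γ (plug K p)
plug (cutLK Δ Θ A Γ K q) p = cut Δ Θ A Γ (plug K p) q
plug (cutRK Δ Θ A Γ q K) p = cut Δ Θ A Γ q (plug K p)
plug (andL1K Θ A B Γ K) p = andL1 Θ A B Γ (plug K p)
plug (andL2K Θ A B Γ K) p = andL2 Θ A B Γ (plug K p)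
plug (andRLK Γ A B K q) p = andR Γ A B (plug K p) q
plug (andRRK Γ A B q K) p = andR Γ A B q (plug K p)
plug (orLLK Θ A B Γ K q) p = orL Θ A B Γ (plug K p) q
plug (orLRK Θ A B Γ q K) p = orL Θ A B Γ q (plug K p)
plug (orR1K Γ A B K) p = orR1 Γ A B (plug K p)
plug (orR2K Γ A B K) p = orR2 Γ A B (plug K p)
plug (impLLK Δ Θ A B Γ K q) p = impL Δ Θ A B Γ (plug K p) q
plug (impLRK Δ Θ A B Γ q K) p = impL Δ Θ A B Γ q (plug K p)
plug (impRK A Γ B K) p = impR A Γ B (plug K p)

infixr 9 _⊚_
_⊚_ : ∀ {H C M E R D} → Ctx M E R D → Ctx H C M E → Ctx H C R D
hole ⊚ L = L
exchK Δ A B Γ K ⊚ L = exchK Δ A B Γ (K ⊚ L)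
contrK Θ A Γ K ⊚ L = contrK Θ A Γ (K ⊚ L)
weakK Θ A Γ K ⊚ L = weakK Θ A Γ (K ⊚ L)
cutLK Δ Θ A Γ K q ⊚ L = cutLK Δ Θ A Γ (K ⊚ L) q
cutRK Δ Θ A Γ q K ⊚ L = cutRK Δ Θ A Γ q (K ⊚ L)
andL1K Θ A B Γ K ⊚ L = andL1K Θ A B Γ (K ⊚ L)
andL2K Θ A B Γ K ⊚ L = andL2K Θ A B Γ (K ⊚ L)
andRLK Γ A B K q ⊚ L = andRLK Γ A B (K ⊚ L) q
andRRK Γ A B q K ⊚ L = andRRK Γ A B q (K ⊚ L)
orLLK Θ A B Γ K q ⊚ L = orLLK Θ A B Γ (K ⊚ L) q
orLRK Θ A B Γ q K ⊚ L = orLRK Θ A B Γ q (K ⊚ L)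
orR1K Γ A B K ⊚ L = orR1K Γ A B (K ⊚ L)
orR2K Γ A B K ⊚ L = orR2K Γ A B (K ⊚ L)
impLLK Δ Θ A B Γ K q ⊚ L = impLLK Δ Θ A B Γ (K ⊚ L) q
impLRK Δ Θ A B Γ q K ⊚ L = impLRK Δ Θ A B Γ q (K ⊚ L)
impRK A Γ B K ⊚ L = impRK A Γ B (K ⊚ L)

-- Clusters via the immediate-ancestor relation, read downwards.
-- Antecedent occurrences are positions (0-based) in the antecedent.
-- Every occurrence of a premise has at most one immediate descendant
-- (an occurrence in the conclusion of which it is an immediate ancestor).
-- Following descendants from an occurrence in the hole of K down to the
-- root of K, one of three things happens:
--   hit  : we reach the occurrence of a cut formula in the right premise
--          of a cut of K (then the start lies in the cluster of it);
--   dead : we reach a displayed (non-context) occurrence which has no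
--          immediate descendant;
--   at j : we reach occurrence j of the antecedent of the root sequent.

data Res : Set where
  hit  : Res
  dead : Res
  at   : ℕ → Res

_>>=R_ : Res → (ℕ → Res) → Res
hit  >>=R f = hit
dead >>=R f = dead
at j >>=R f = f j

-- immediate-descendant steps, t = length of the left context Θ / Δ
stepExch : ℕ → ℕ → Res
stepExch t i = if i <ᵇ t then at i else
               (if i ≡ᵇ t then at (suc t) else
               (if i ≡ᵇ suc t then at t else at i))

stepContr : ℕ → ℕ → Res
stepContr t i = if i <ᵇ t then at i else
                (if (i ≡ᵇ t) ∨ (i ≡ᵇ suc t) then at t else at (pred i))

stepWeak : ℕ → ℕ → Res
stepWeak t i = if i <ᵇ t then at i else at (suc i)

-- premise Θ ++ A ∷ Γ of a cut with left premise antecedent of length d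
stepCutR : ℕ → ℕ → ℕ → Res
stepCutR t d i = if i <ᵇ t then at i else
                 (if i ≡ᵇ t then hit else at ((i ∸ 1) + d))

-- premise Θ ++ A ∷ Γ of a left rule with principal at position t
stepPrincipal : ℕ → ℕ → Res
stepPrincipal t i = if i ≡ᵇ t then dead else at i

-- right premise Θ ++ B ∷ Γ of (→L), left premise of length d
stepImpLR : ℕ → ℕ → ℕ → Res
stepImpLR t d i = if i <ᵇ t then at i else
                  (if i ≡ᵇ t then dead else at (i + d))

stepImpR : ℕ → Res
stepImpR zero    = dead
stepImpR (suc i) = at i

trace : ∀ {Γ₀ C₀ Γ C} → Ctx Γ₀ C₀ Γ C → ℕ → Res
trace hole i = at i
trace (exchK Δ A B Γ K) i = trace K i >>=R stepExch (length Δ)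
trace (contrK Θ A Γ K) i = trace K i >>=R stepContr (length Θ)
trace (weakK Θ A Γ K) i = trace K i >>=R stepWeak (length Θ)
trace (cutLK Δ Θ A Γ K q) i = trace K i >>=R λ j → at (length Θ + j)
trace (cutRK Δ Θ A Γ q K) i = trace K i >>=R stepCutR (length Θ) (length Δ)
trace (andL1K Θ A B Γ K) i = trace K i >>=R stepPrincipal (length Θ)
trace (andL2K Θ A B Γ K) i = trace K i >>=R stepPrincipal (length Θ)
trace (andRLK Γ A B K q) i = trace K i
trace (andRRK Γ A B q K) i = trace K i
trace (orLLK Θ A B Γ K q) i = trace K i >>=R stepPrincipal (length Θ)
trace (orLRK Θ A B Γ q K) i = trace K i >>=R stepPrincipal (length Θ)
trace (orR1K Γ A B K) i = trace K i
trace (orR2K Γ A B K) i = trace K i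
trace (impLLK Δ Θ A B Γ K q) i = trace K i >>=R λ j → at (length Θ + j)
trace (impLRK Δ Θ A B Γ q K) i = trace K i >>=R stepImpLR (length Θ) (length Δ)
trace (impRK A Γ B K) i = trace K i >>=R stepImpR

InCutCluster : ∀ {Γ₀ C₀ Γ C} → Ctx Γ₀ C₀ Γ C → ℕ → Set
InCutCluster K i = trace K i ≡ hit
  where open import Relation.Binary.PropositionalEquality using (_≡_)

-- An application  contr Θ A Γ p  occurring in the proof  plug K (contr Θ A Γ p)
-- is engaged iff its principal occurrence (position length Θ of its
-- conclusion, which is the hole of K) is InCutCluster K; otherwise neutral.

isHit : Res → ℕ
isHit hit    = 1
isHit dead   = 0
isHit (at _) = 0

notHit : Res → ℕ
notHit hit    = 0
notHit dead   = 1
notHit (at _) = 1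

-- Consecutive applications of (W), resp. (C), leading from antecedent Φ
-- to antecedent Ψ (same succedent).  The outermost step is the lowest.

data WChain (Φ : List Fm) : List Fm → Set where
  wnil  : WChain Φ Φ
  wstep : ∀ Θ A Γ → WChain Φ (Θ ++ A ∷ A ∷ Γ) → WChain Φ (Θ ++ A ∷ Γ)

data CChain (Φ : List Fm) : List Fm → Set where
  cnil  : CChain Φ Φ
  cstep : ∀ Δ A B Γ → CChain Φ (Δ ++ A ∷ B ∷ Γ) → CChain Φ (Δ ++ B ∷ A ∷ Γ)

wCtx : ∀ {Φ Ψ C} → WChain Φ Ψ → Ctx Φ C Ψ C
wCtx wnil = hole
wCtx (wstep Θ A Γ w) = contrK Θ A Γ (wCtx w)

cCtx : ∀ {Φ Ψ C} → CChain Φ Ψ → Ctx Φ C Ψ C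
cCtx cnil = hole
cCtx (cstep Δ A B Γ c) = exchK Δ A B Γ (cCtx c)

wLength : ∀ {Φ Ψ} → WChain Φ Ψ → ℕ
wLength wnil = 0
wLength (wstep _ _ _ w) = suc (wLength w)

-- number of the (W)-applications of the chain w that are engaged, resp.
-- neutral, in a proof  plug K (plug (wCtx w) ρ)  (for any ρ), where K is
-- the rest of the proof below the chain.
engagedCount : ∀ {Φ Ψ C Γ D} → Ctx Ψ C Γ D → WChain Φ Ψ → ℕ
engagedCount K wnil = 0
engagedCount K (wstep Θ A Γ w) =
  isHit (trace K (length Θ)) + engagedCount (K ⊚ contrK Θ A Γ hole) w

neutralCount : ∀ {Φ Ψ C Γ D} → Ctx Ψ C Γ D → WChain Φ Ψ → ℕ
neutralCount K wnil = 0
neutralCount K (wstep Θ A Γ w) =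
  notHit (trace K (length Θ)) + neutralCount (K ⊚ contrK Θ A Γ hole) w

{-# OPTIONS --safe #-}
-- Each application of (C) below an application of (W) can be moved above it. If the
-- contracted formula is not one of the exchanged pair, the two inferences simply commute;
-- if it is, the (W) becomes two applications of (C) followed by one (W). Structural
-- inferences do not touch cuts, so the degree is unchanged. Whether a (W) of the segment is
-- engaged depends only on the proof below Ψ ⊢ C and on the position in Ψ of the descendant
-- of its principal occurrence, and the reordering sends these positions for the old
-- contractions, pushed through the exchanges, exactly onto those for the new ones.
module Submission where

open import Defs
open import Data.Bool using (true; false; _∨_)
open import Data.List using (List; []; _∷_; _++_; length; map)
open import Data.List.Properties
  using (∷-injectiveˡ; ∷-injectiveʳ; map-cong; map-∘; length-map)
open import Data.Nat.ListAction using (sum)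
open import Data.Nat using (ℕ; zero; suc; _+_; _⊔_; _<ᵇ_; _≡ᵇ_)
open import Data.Product using (Σ; _×_; _,_)
open import Function using (_∘_)
open import Relation.Binary.PropositionalEquality
  using (_≡_; refl; sym; trans; cong; cong₂; module ≡-Reasoning)

open ≡-Reasoning

exchDesc : ℕ → ℕ → ℕ
exchDesc zero    zero          = 1
exchDesc zero    (suc zero)    = 0
exchDesc zero    (suc (suc i)) = suc (suc i)
exchDesc (suc t) zero          = zero
exchDesc (suc t) (suc i)       = suc (exchDesc t i)

contrDesc : ℕ → ℕ → ℕ
contrDesc zero    zero          = 0
contrDesc zero    (suc zero)    = 0
contrDesc zero    (suc (suc i)) = suc i
contrDesc (suc t) zero          = zero
contrDesc (suc t) (suc i)       = suc (contrDesc t i)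

shift : Res → Res
shift r = r >>=R (at ∘ suc)

stepExch-suc : ∀ t i → stepExch (suc t) (suc i) ≡ shift (stepExch t i)
stepExch-suc t i with i <ᵇ t | i ≡ᵇ t | i ≡ᵇ suc t
... | true  | _     | _     = refl
... | false | true  | _     = refl
... | false | false | true  = refl
... | false | false | false = refl

stepExch≡exchDesc : ∀ t i → stepExch t i ≡ at (exchDesc t i)
stepExch≡exchDesc zero    zero          = refl
stepExch≡exchDesc zero    (suc zero)    = refl
stepExch≡exchDesc zero    (suc (suc i)) = refl
stepExch≡exchDesc (suc t) zero          = refl
stepExch≡exchDesc (suc t) (suc i)       =
  trans (stepExch-suc t i) (cong shift (stepExch≡exchDesc t i))

-- Only from position 2 on: on position 1 the (unreachable) last branch of stepContr would
-- meet pred 0 = 0.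
stepContr-suc : ∀ t i → stepContr (suc t) (suc (suc i)) ≡ shift (stepContr t (suc i))
stepContr-suc t i with suc i <ᵇ t | (suc i ≡ᵇ t) ∨ (suc i ≡ᵇ suc t)
... | true  | _     = refl
... | false | true  = refl
... | false | false = refl

stepContr≡contrDesc : ∀ t i → stepContr t i ≡ at (contrDesc t i)
stepContr≡contrDesc zero          zero          = refl
stepContr≡contrDesc zero          (suc zero)    = refl
stepContr≡contrDesc zero          (suc (suc i)) = refl
stepContr≡contrDesc (suc t)       zero          = refl
stepContr≡contrDesc (suc zero)    (suc zero)    = refl
stepContr≡contrDesc (suc (suc t)) (suc zero)    = refl
stepContr≡contrDesc (suc t)       (suc (suc i)) =
  trans (stepContr-suc t i) (cong shift (stepContr≡contrDesc t (suc i)))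

>>=R-identityʳ : ∀ r → (r >>=R at) ≡ r
>>=R-identityʳ hit    = refl
>>=R-identityʳ dead   = refl
>>=R-identityʳ (at j) = refl

>>=R-assoc : ∀ r (f g : ℕ → Res) → ((r >>=R f) >>=R g) ≡ (r >>=R λ j → f j >>=R g)
>>=R-assoc hit    f g = refl
>>=R-assoc dead   f g = refl
>>=R-assoc (at j) f g = refl

>>=R-extend : ∀ {r} s (f g : ℕ → Res) → r ≡ (s >>=R f) → (r >>=R g) ≡ (s >>=R λ j → f j >>=R g)
>>=R-extend s f g refl = >>=R-assoc s f g

trace-⊚ : ∀ {H C M E R D} (K : Ctx M E R D) (L : Ctx H C M E) i →
          trace (K ⊚ L) i ≡ (trace L i >>=R trace K)
trace-⊚ hole                   L i = sym (>>=R-identityʳ (trace L i))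
trace-⊚ (exchK _ _ _ _ K)      L i = >>=R-extend (trace L i) (trace K) _ (trace-⊚ K L i)
trace-⊚ (contrK _ _ _ K)       L i = >>=R-extend (trace L i) (trace K) _ (trace-⊚ K L i)
trace-⊚ (weakK _ _ _ K)        L i = >>=R-extend (trace L i) (trace K) _ (trace-⊚ K L i)
trace-⊚ (cutLK _ _ _ _ K _)    L i = >>=R-extend (trace L i) (trace K) _ (trace-⊚ K L i)
trace-⊚ (cutRK _ _ _ _ _ K)    L i = >>=R-extend (trace L i) (trace K) _ (trace-⊚ K L i)
trace-⊚ (andL1K _ _ _ _ K)     L i = >>=R-extend (trace L i) (trace K) _ (trace-⊚ K L i)
trace-⊚ (andL2K _ _ _ _ K)     L i = >>=R-extend (trace L i) (trace K) _ (trace-⊚ K L i)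
trace-⊚ (andRLK _ _ _ K _)     L i = trace-⊚ K L i
trace-⊚ (andRRK _ _ _ _ K)     L i = trace-⊚ K L i
trace-⊚ (orLLK _ _ _ _ K _)    L i = >>=R-extend (trace L i) (trace K) _ (trace-⊚ K L i)
trace-⊚ (orLRK _ _ _ _ _ K)    L i = >>=R-extend (trace L i) (trace K) _ (trace-⊚ K L i)
trace-⊚ (orR1K _ _ _ K)        L i = trace-⊚ K L i
trace-⊚ (orR2K _ _ _ K)        L i = trace-⊚ K L i
trace-⊚ (impLLK _ _ _ _ _ K _) L i = >>=R-extend (trace L i) (trace K) _ (trace-⊚ K L i)
trace-⊚ (impLRK _ _ _ _ _ _ K) L i = >>=R-extend (trace L i) (trace K) _ (trace-⊚ K L i)
trace-⊚ (impRK _ _ _ K)        L i = >>=R-extend (trace L i) (trace K) _ (trace-⊚ K L i)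

map-trace-⊚ : ∀ {H C M E R D} (K : Ctx M E R D) (L : Ctx H C M E) {g : ℕ → ℕ} →
              (∀ i → trace L i ≡ at (g i)) →
              ∀ is → map (trace (K ⊚ L)) is ≡ map (trace K) (map g is)
map-trace-⊚ K L {g} trace-L is = begin
  map (trace (K ⊚ L)) is    ≡⟨ map-cong trace-K⊚L is ⟩
  map (trace K ∘ g) is      ≡⟨ map-∘ is ⟩
  map (trace K) (map g is)  ∎
  where
  trace-K⊚L : ∀ i → trace (K ⊚ L) i ≡ trace K (g i)
  trace-K⊚L i = trans (trace-⊚ K L i) (cong (_>>=R trace K) (trace-L i))

map-trace-⊚-contrK : ∀ {C Γ D} Θ A Γ′ (K : Ctx (Θ ++ A ∷ Γ′) C Γ D) is →
                     map (trace (K ⊚ contrK Θ A Γ′ hole)) is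
                       ≡ map (trace K) (map (contrDesc (length Θ)) is)
map-trace-⊚-contrK Θ A Γ′ K = map-trace-⊚ K (contrK Θ A Γ′ hole) (stepContr≡contrDesc (length Θ))

chainDesc : ∀ {Φ Ψ} → CChain Φ Ψ → ℕ → ℕ
chainDesc cnil              i = i
chainDesc (cstep Δ _ _ _ c) i = exchDesc (length Δ) (chainDesc c i)

trace-cCtx : ∀ {Φ Ψ C} (c : CChain Φ Ψ) i → trace (cCtx {C = C} c) i ≡ at (chainDesc c i)
trace-cCtx cnil              i = refl
trace-cCtx (cstep Δ _ _ _ c) i =
  trans (cong (_>>=R stepExch (length Δ)) (trace-cCtx c i))
        (stepExch≡exchDesc (length Δ) (chainDesc c i))

infixr 5 _++ᶜ_
_++ᶜ_ : ∀ {Φ Ψ Ξ} → CChain Φ Ψ → CChain Ψ Ξ → CChain Φ Ξ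
c ++ᶜ cnil              = c
c ++ᶜ cstep Δ A B Γ c′  = cstep Δ A B Γ (c ++ᶜ c′)

chainDesc-++ᶜ : ∀ {Φ Ψ Ξ} (c : CChain Φ Ψ) (c′ : CChain Ψ Ξ) i →
                chainDesc (c ++ᶜ c′) i ≡ chainDesc c′ (chainDesc c i)
chainDesc-++ᶜ c cnil                i = refl
chainDesc-++ᶜ c (cstep Δ _ _ _ c′)  i = cong (exchDesc (length Δ)) (chainDesc-++ᶜ c c′ i)

infixr 5 _∷ᶜ_
_∷ᶜ_ : ∀ T {Φ Ψ} → CChain Φ Ψ → CChain (T ∷ Φ) (T ∷ Ψ)
T ∷ᶜ cnil              = cnil
T ∷ᶜ cstep Δ A B Γ c   = cstep (T ∷ Δ) A B Γ (T ∷ᶜ c)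

chainDesc-∷ᶜ-zero : ∀ T {Φ Ψ} (c : CChain Φ Ψ) → chainDesc (T ∷ᶜ c) zero ≡ zero
chainDesc-∷ᶜ-zero T cnil              = refl
chainDesc-∷ᶜ-zero T (cstep Δ _ _ _ c) = cong (exchDesc (suc (length Δ))) (chainDesc-∷ᶜ-zero T c)

chainDesc-∷ᶜ-suc : ∀ T {Φ Ψ} (c : CChain Φ Ψ) i → chainDesc (T ∷ᶜ c) (suc i) ≡ suc (chainDesc c i)
chainDesc-∷ᶜ-suc T cnil              i = refl
chainDesc-∷ᶜ-suc T (cstep Δ _ _ _ c) i = cong (exchDesc (suc (length Δ))) (chainDesc-∷ᶜ-suc T c i)

principalDescendants : ∀ {Φ Ψ} → WChain Φ Ψ → List ℕ
principalDescendants wnil            = []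
principalDescendants (wstep Θ _ _ w) = length Θ ∷ map (contrDesc (length Θ)) (principalDescendants w)

length-principalDescendants : ∀ {Φ Ψ} (w : WChain Φ Ψ) → length (principalDescendants w) ≡ wLength w
length-principalDescendants wnil            = refl
length-principalDescendants (wstep Θ _ _ w) =
  cong suc (trans (length-map (contrDesc (length Θ)) (principalDescendants w))
                  (length-principalDescendants w))

engagedCount-principalDescendants :
  ∀ {Φ Ψ C Γ D} (K : Ctx Ψ C Γ D) (w : WChain Φ Ψ) →
  engagedCount K w ≡ sum (map isHit (map (trace K) (principalDescendants w)))
engagedCount-principalDescendants K wnil            = refl
engagedCount-principalDescendants K (wstep Θ A Γ w) =
  cong (isHit (trace K (length Θ)) +_)
       (trans (engagedCount-principalDescendants (K ⊚ contrK Θ A Γ hole) w)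
              (cong (sum ∘ map isHit) (map-trace-⊚-contrK Θ A Γ K (principalDescendants w))))

neutralCount-principalDescendants :
  ∀ {Φ Ψ C Γ D} (K : Ctx Ψ C Γ D) (w : WChain Φ Ψ) →
  neutralCount K w ≡ sum (map notHit (map (trace K) (principalDescendants w)))
neutralCount-principalDescendants K wnil            = refl
neutralCount-principalDescendants K (wstep Θ A Γ w) =
  cong (notHit (trace K (length Θ)) +_)
       (trans (neutralCount-principalDescendants (K ⊚ contrK Θ A Γ hole) w)
              (cong (sum ∘ map notHit) (map-trace-⊚-contrK Θ A Γ K (principalDescendants w))))

wLength-cong : ∀ {Φ Ψ Φ′ Ψ′} (w : WChain Φ Ψ) (w′ : WChain Φ′ Ψ′) {f : ℕ → ℕ} →
               principalDescendants w ≡ map f (principalDescendants w′) → wLength w ≡ wLength w′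
wLength-cong w w′ {f} eq = begin
  wLength w                                 ≡⟨ length-principalDescendants w ⟨
  length (principalDescendants w)           ≡⟨ cong length eq ⟩
  length (map f (principalDescendants w′))  ≡⟨ length-map f (principalDescendants w′) ⟩
  length (principalDescendants w′)          ≡⟨ length-principalDescendants w′ ⟩
  wLength w′                                ∎

engagedCount-cong : ∀ {Φ Ψ C Γ D Φ′ Ψ′ C′ Γ′ D′} (K : Ctx Ψ C Γ D) (K′ : Ctx Ψ′ C′ Γ′ D′)
                    (w : WChain Φ Ψ) (w′ : WChain Φ′ Ψ′) →
                    map (trace K) (principalDescendants w) ≡ map (trace K′) (principalDescendants w′) →
                    engagedCount K w ≡ engagedCount K′ w′
engagedCount-cong K K′ w w′ eq = begin
  engagedCount K w
    ≡⟨ engagedCount-principalDescendants K w ⟩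
  sum (map isHit (map (trace K) (principalDescendants w)))
    ≡⟨ cong (sum ∘ map isHit) eq ⟩
  sum (map isHit (map (trace K′) (principalDescendants w′)))
    ≡⟨ engagedCount-principalDescendants K′ w′ ⟨
  engagedCount K′ w′ ∎

neutralCount-cong : ∀ {Φ Ψ C Γ D Φ′ Ψ′ C′ Γ′ D′} (K : Ctx Ψ C Γ D) (K′ : Ctx Ψ′ C′ Γ′ D′)
                    (w : WChain Φ Ψ) (w′ : WChain Φ′ Ψ′) →
                    map (trace K) (principalDescendants w) ≡ map (trace K′) (principalDescendants w′) →
                    neutralCount K w ≡ neutralCount K′ w′
neutralCount-cong K K′ w w′ eq = begin
  neutralCount K w
    ≡⟨ neutralCount-principalDescendants K w ⟩
  sum (map notHit (map (trace K) (principalDescendants w)))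
    ≡⟨ cong (sum ∘ map notHit) eq ⟩
  sum (map notHit (map (trace K′) (principalDescendants w′)))
    ≡⟨ neutralCount-principalDescendants K′ w′ ⟨
  neutralCount K′ w′ ∎

degree-plug-cong : ∀ {Γ₀ C₀ Γ C} (K : Ctx Γ₀ C₀ Γ C) {p q : Pf Γ₀ C₀} →
                   degree p ≡ degree q → degree (plug K p) ≡ degree (plug K q)
degree-plug-cong hole                    eq = eq
degree-plug-cong (exchK _ _ _ _ K)       eq = degree-plug-cong K eq
degree-plug-cong (contrK _ _ _ K)        eq = degree-plug-cong K eq
degree-plug-cong (weakK _ _ _ K)         eq = degree-plug-cong K eq
degree-plug-cong (cutLK _ _ A _ K r)     eq = cong (λ d → conn A ⊔ (d ⊔ degree r)) (degree-plug-cong K eq)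
degree-plug-cong (cutRK _ _ A _ r K)     eq = cong (λ d → conn A ⊔ (degree r ⊔ d)) (degree-plug-cong K eq)
degree-plug-cong (andL1K _ _ _ _ K)      eq = degree-plug-cong K eq
degree-plug-cong (andL2K _ _ _ _ K)      eq = degree-plug-cong K eq
degree-plug-cong (andRLK _ _ _ K r)      eq = cong (_⊔ degree r) (degree-plug-cong K eq)
degree-plug-cong (andRRK _ _ _ r K)      eq = cong (degree r ⊔_) (degree-plug-cong K eq)
degree-plug-cong (orLLK _ _ _ _ K r)     eq = cong (_⊔ degree r) (degree-plug-cong K eq)
degree-plug-cong (orLRK _ _ _ _ r K)     eq = cong (degree r ⊔_) (degree-plug-cong K eq)
degree-plug-cong (orR1K _ _ _ K)         eq = degree-plug-cong K eq
degree-plug-cong (orR2K _ _ _ K)         eq = degree-plug-cong K eq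
degree-plug-cong (impLLK _ _ _ _ _ K r)  eq = cong (_⊔ degree r) (degree-plug-cong K eq)
degree-plug-cong (impLRK _ _ _ _ _ r K)  eq = cong (degree r ⊔_) (degree-plug-cong K eq)
degree-plug-cong (impRK _ _ _ K)         eq = degree-plug-cong K eq

degree-plug-wCtx : ∀ {Φ Ψ C} (w : WChain Φ Ψ) (p : Pf Φ C) → degree (plug (wCtx w) p) ≡ degree p
degree-plug-wCtx wnil            p = refl
degree-plug-wCtx (wstep _ _ _ w) p = degree-plug-wCtx w p

degree-plug-cCtx : ∀ {Φ Ψ C} (c : CChain Φ Ψ) (p : Pf Φ C) → degree (plug (cCtx c) p) ≡ degree p
degree-plug-cCtx cnil              p = refl
degree-plug-cCtx (cstep _ _ _ _ c) p = degree-plug-cCtx c p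

-- A contraction at position length Θ followed by exchanges with descendant map desc, redone
-- as exchanges followed by a contraction at length Θ′ so that every occurrence ends up at
-- the same position of Ψ.
record ExchangesFirst (Θ : List Fm) (A : Fm) (Γ′ Ψ : List Fm) (desc : ℕ → ℕ) : Set where
  field
    Θ′ : List Fm
    B : Fm
    Γ″ : List Fm
    exchanges  : CChain (Θ ++ A ∷ A ∷ Γ′) (Θ′ ++ B ∷ B ∷ Γ″)
    conclusion : Θ′ ++ B ∷ Γ″ ≡ Ψ
    principal  : desc (length Θ) ≡ length Θ′
    square     : ∀ i → desc (contrDesc (length Θ) i) ≡ contrDesc (length Θ′) (chainDesc exchanges i)

exchangesFirst-∷ : ∀ T {Θ A Γ′ Ψ t} → ExchangesFirst Θ A Γ′ Ψ (exchDesc t) →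
                   ExchangesFirst (T ∷ Θ) A Γ′ (T ∷ Ψ) (exchDesc (suc t))
exchangesFirst-∷ T r = record
  { Θ′ = T ∷ Θ′ ; B = B ; Γ″ = Γ″
  ; exchanges  = T ∷ᶜ exchanges
  ; conclusion = cong (T ∷_) conclusion
  ; principal  = cong suc principal
  ; square     = λ where
      zero    → cong (contrDesc (suc (length Θ′))) (sym (chainDesc-∷ᶜ-zero T exchanges))
      (suc i) → trans (cong suc (square i))
                      (cong (contrDesc (suc (length Θ′))) (sym (chainDesc-∷ᶜ-suc T exchanges i)))
  }
  where open ExchangesFirst r

exchangesFirst₁ : ∀ Θ A Γ′ Δ X Y Γ → Θ ++ A ∷ Γ′ ≡ Δ ++ X ∷ Y ∷ Γ →
                  ExchangesFirst Θ A Γ′ (Δ ++ Y ∷ X ∷ Γ) (exchDesc (length Δ))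
exchangesFirst₁ [] A Γ′ [] X Y Γ refl = record
  { Θ′ = Y ∷ [] ; B = X ; Γ″ = Γ
  ; exchanges  = cstep [] X Y (X ∷ Γ) (cstep (X ∷ []) X Y Γ cnil)
  ; conclusion = refl
  ; principal  = refl
  ; square     = λ where
      zero                → refl
      (suc zero)          → refl
      (suc (suc zero))    → refl
      (suc (suc (suc i))) → refl
  }
exchangesFirst₁ [] A Γ′ (_ ∷ Δ) X Y Γ refl = record
  { Θ′ = [] ; B = A ; Γ″ = Δ ++ Y ∷ X ∷ Γ
  ; exchanges  = cstep (A ∷ A ∷ Δ) X Y Γ cnil
  ; conclusion = refl
  ; principal  = refl
  ; square     = λ where
      zero          → refl
      (suc zero)    → refl
      (suc (suc i)) → refl
  }
exchangesFirst₁ (_ ∷ []) A Γ′ [] X Y Γ refl = record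
  { Θ′ = [] ; B = A ; Γ″ = X ∷ Γ
  ; exchanges  = cstep (A ∷ []) X A Γ (cstep [] X A (A ∷ Γ) cnil)
  ; conclusion = refl
  ; principal  = refl
  ; square     = λ where
      zero                → refl
      (suc zero)          → refl
      (suc (suc zero))    → refl
      (suc (suc (suc i))) → refl
  }
exchangesFirst₁ (_ ∷ _ ∷ Θ) A Γ′ [] X Y Γ refl = record
  { Θ′ = Y ∷ X ∷ Θ ; B = A ; Γ″ = Γ′
  ; exchanges  = cstep [] X Y (Θ ++ A ∷ A ∷ Γ′) cnil
  ; conclusion = refl
  ; principal  = refl
  ; square     = λ where
      zero          → refl
      (suc zero)    → refl
      (suc (suc i)) → refl
  }
exchangesFirst₁ (T ∷ Θ) A Γ′ (_ ∷ Δ) X Y Γ eq with refl ← ∷-injectiveˡ eq =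
  exchangesFirst-∷ T (exchangesFirst₁ Θ A Γ′ Δ X Y Γ (∷-injectiveʳ eq))

exchangesFirst : ∀ Θ A Γ′ {Ψ} (cs : CChain (Θ ++ A ∷ Γ′) Ψ) → ExchangesFirst Θ A Γ′ Ψ (chainDesc cs)
exchangesFirst Θ A Γ′ cnil = record
  { Θ′ = Θ ; B = A ; Γ″ = Γ′
  ; exchanges  = cnil
  ; conclusion = refl
  ; principal  = refl
  ; square     = λ i → refl
  }
exchangesFirst Θ A Γ′ (cstep Δ X Y Γ cs) = record
  { Θ′ = Θ₂ ; B = B₂ ; Γ″ = Γ₂
  ; exchanges  = ex₁ ++ᶜ ex₂
  ; conclusion = conclusion₂
  ; principal  = trans (cong (exchDesc (length Δ)) principal₁) principal₂
  ; square     = λ i → begin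
      exchDesc (length Δ) (chainDesc cs (contrDesc (length Θ) i))
        ≡⟨ cong (exchDesc (length Δ)) (square₁ i) ⟩
      exchDesc (length Δ) (contrDesc (length Θ₁) (chainDesc ex₁ i))
        ≡⟨ square₂ (chainDesc ex₁ i) ⟩
      contrDesc (length Θ₂) (chainDesc ex₂ (chainDesc ex₁ i))
        ≡⟨ cong (contrDesc (length Θ₂)) (sym (chainDesc-++ᶜ ex₁ ex₂ i)) ⟩
      contrDesc (length Θ₂) (chainDesc (ex₁ ++ᶜ ex₂) i) ∎
  }
  where
  open ExchangesFirst (exchangesFirst Θ A Γ′ cs)
    renaming (Θ′ to Θ₁; B to B₁; Γ″ to Γ₁; exchanges to ex₁; conclusion to conclusion₁;
              principal to principal₁; square to square₁)
  open ExchangesFirst (exchangesFirst₁ Θ₁ B₁ Γ₁ Δ X Y Γ conclusion₁)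
    renaming (Θ′ to Θ₂; B to B₂; Γ″ to Γ₂; exchanges to ex₂; conclusion to conclusion₂;
              principal to principal₂; square to square₂)

reorderSegment : ∀ {Φ Φ₁ Ψ} (cs : CChain Φ₁ Ψ) (ws : WChain Φ Φ₁) →
  Σ (List Fm) λ Φ₂ → Σ (CChain Φ Φ₂) λ cs′ → Σ (WChain Φ₂ Ψ) λ ws′ →
    principalDescendants ws′ ≡ map (chainDesc cs) (principalDescendants ws)
reorderSegment cs wnil = _ , cs , wnil , refl
reorderSegment cs (wstep Θ A Γ′ ws) with exchangesFirst Θ A Γ′ cs
... | record { Θ′ = Θ′ ; B = B ; Γ″ = Γ″ ; exchanges = ex ; conclusion = refl
             ; principal = principal ; square = square }
  with reorderSegment ex ws
... | Φ₂ , cs′ , ws′ , ws′≡ = Φ₂ , cs′ , wstep Θ′ B Γ″ ws′ , cong₂ _∷_ (sym principal) (begin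
  map (contrDesc (length Θ′)) (principalDescendants ws′)
    ≡⟨ cong (map (contrDesc (length Θ′))) ws′≡ ⟩
  map (contrDesc (length Θ′)) (map (chainDesc ex) (principalDescendants ws))
    ≡⟨ map-∘ (principalDescendants ws) ⟨
  map (contrDesc (length Θ′) ∘ chainDesc ex) (principalDescendants ws)
    ≡⟨ map-cong square (principalDescendants ws) ⟨
  map (chainDesc cs ∘ contrDesc (length Θ)) (principalDescendants ws)
    ≡⟨ map-∘ (principalDescendants ws) ⟩
  map (chainDesc cs) (map (contrDesc (length Θ)) (principalDescendants ws)) ∎)

lemma5p1 : ∀ {Φ Φ₁ Ψ Γ : List Fm} {C D : Fm}
    (K : Ctx Ψ C Γ D) (cs : CChain Φ₁ Ψ) (ws : WChain Φ Φ₁) (ρ : Pf Φ C) (e n : ℕ) →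
    wLength ws ≡ e + n →
    engagedCount (K ⊚ cCtx cs) ws ≡ e →
    neutralCount (K ⊚ cCtx cs) ws ≡ n →
    Σ (List Fm) λ Φ₂ → Σ (CChain Φ Φ₂) λ cs′ → Σ (WChain Φ₂ Ψ) λ ws′ →
      wLength ws′ ≡ e + n × engagedCount K ws′ ≡ e × neutralCount K ws′ ≡ n ×
      degree (plug K (plug (wCtx ws′) (plug (cCtx cs′) ρ)))
        ≡ degree (plug K (plug (cCtx cs) (plug (wCtx ws) ρ)))
lemma5p1 K cs ws ρ e n length≡ engaged≡ neutral≡ with reorderSegment cs ws
... | Φ₂ , cs′ , ws′ , ws′≡ =
  Φ₂ , cs′ , ws′ ,
  trans (wLength-cong ws′ ws ws′≡) length≡ ,
  trans (engagedCount-cong K (K ⊚ cCtx cs) ws′ ws traces≡) engaged≡ ,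
  trans (neutralCount-cong K (K ⊚ cCtx cs) ws′ ws traces≡) neutral≡ ,
  degree-plug-cong K (begin
    degree (plug (wCtx ws′) (plug (cCtx cs′) ρ))  ≡⟨ degree-plug-wCtx ws′ _ ⟩
    degree (plug (cCtx cs′) ρ)                    ≡⟨ degree-plug-cCtx cs′ ρ ⟩
    degree ρ                                      ≡⟨ degree-plug-wCtx ws ρ ⟨
    degree (plug (wCtx ws) ρ)                     ≡⟨ degree-plug-cCtx cs _ ⟨
    degree (plug (cCtx cs) (plug (wCtx ws) ρ))    ∎)
  where
  traces≡ : map (trace K) (principalDescendants ws′)
              ≡ map (trace (K ⊚ cCtx cs)) (principalDescendants ws)
  traces≡ = trans (cong (map (trace K)) ws′≡)
                  (sym (map-trace-⊚ K (cCtx cs) (trace-cCtx cs) (principalDescendants ws)))
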